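{- Let $a,b$ be coprime positive integers with $a>1$, let $z$ be an integer, and define $s_n=z-b\cdot\frac{a^n-1}{a-1}$ for $n\ge1$ (so $s_1=z-b$ and $s_{n+1}=s_n-a^nb$). Let $p$ be a prime factor of $a$. Then for each $n\in\mathbb{Z}^+$: if $\nu_p(s_n)>n\nu_p(a)$ then $\nu_p(s_{n+1})=n\nu_p(a)$; otherwise $\nu_p(s_{n+1})\ge\nu_p(s_n)$. Moreover, if $\nu_p(s_{n+1})=n\nu_p(a)$ for some $n\in\mathbb{Z}^+$, then $\nu_p(s_{n_1})=n\nu_p(a)$ for every integer $n_1>n$.
   Context: $\nu_p(x)$ denotes the $p$-adic valuation of the integer $x$ (the exponent of $p$ in the prime factorization of $x$), with the convention $\nu_p(0)=+\infty$. -}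

module Defs where

open import Data.Nat using (ℕ; zero; suc; _^_) renaming (_*_ to _*ℕ_; _+_ to _+ℕ_)
open import Data.Nat.Divisibility using () renaming (_∣_ to _∣ℕ_)
open import Data.Integer using (ℤ; +_; _-_; ∣_∣)
open import Data.Product using (_×_)
open import Relation.Nullary using (¬_)

-- geometric sum  1 + a + ... + a^(n-1)  =  (a^n - 1)/(a - 1)
geom : ℕ → ℕ → ℕ
geom a zero    = 0
geom a (suc n) = geom a n +ℕ a ^ n

s : ℤ → ℕ → ℕ → ℕ → ℤ
s z a b n = z - + (b *ℕ geom a n)

-- p-adic valuation of an integer, expressed relationally
-- (ν_p(0) = +∞ is automatic: every p^k divides 0).
-- ν_p(x) ≥ k
ν≥ : ℕ → ℤ → ℕ → Set
ν≥ p x k = (p ^ k) ∣ℕ ∣ x ∣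

ν> : ℕ → ℤ → ℕ → Set
ν> p x k = ν≥ p x (suc k)

ν≡ : ℕ → ℤ → ℕ → Set
ν≡ p x k = ν≥ p x k × ¬ ν> p x k

ν≤ν : ℕ → ℤ → ℤ → Set
ν≤ν p x y = ∀ k → ν≥ p x k → ν≥ p y k

-- Since s (n + 1) = s n − aⁿ b and p ∤ b, the subtracted term has valuation exactly n ν_p(a).
-- Everything then follows from the ultrametric behaviour of ν_p under subtraction: the
-- difference of two integers of different valuations has the smaller one, and once
-- ν_p(s (n + 1)) = n ν_p(a), every later term subtracts something of strictly larger valuation.
module Submission where

open import Defs
open import Data.Nat using (ℕ; zero; suc; s≤s; _*_; _+_; _^_; _<_; _≤_; NonZero)
open import Data.Nat.Properties
  using (_≤?_; ≰⇒>; m≤n⇒∃[o]m+o≡n; n≤1+n; *-identityʳ; +-identityʳ; *-comm; *-distribˡ-+;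
         *-commutativeSemigroup; *-monoˡ-<; ^-distribˡ-+-*; m^n≢0; m≤n⇒m<n∨m≡n)
open import Data.Nat.Divisibility
  using (_∣_; divides-refl; 1∣_; ∣-trans; ∣1⇒≡1; m∣m*n; n∣m*n; *-monoˡ-∣; *-cancelʳ-∣)
open import Data.Nat.Coprimality using (Coprime)
open import Data.Nat.Primality using (Prime; euclidsLemma; prime⇒nonZero; ¬prime[1])
open import Data.Integer using (ℤ; +_; _-_; -_)
import Data.Integer as ℤ
open import Data.Integer.Properties using (neg-involutive; neg-distrib-+; +-assoc; pos-+)
open import Data.Integer.Divisibility.Signed renaming (_∣_ to _∣ˢ_)
  using (∣ᵤ⇒∣; ∣⇒∣ᵤ; ∣m∣n⇒∣m-n; ∣m+n∣n⇒∣m; ∣m+n∣m⇒∣n; ∣m⇒∣-m)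
open import Algebra.Properties.CommutativeSemigroup *-commutativeSemigroup using (interchange)
open import Data.Product using (_×_; _,_; proj₁)
open import Data.Sum using (inj₁; inj₂; [_,_])
open import Data.Empty using (⊥-elim)
open import Relation.Nullary using (¬_; yes; no)
open import Relation.Binary.PropositionalEquality using (_≡_; refl; sym; trans; cong; subst; module ≡-Reasoning)

^-monoʳ-∣ : ∀ m {i j} → i ≤ j → m ^ i ∣ m ^ j
^-monoʳ-∣ m {i} i≤j with m≤n⇒∃[o]m+o≡n i≤j
... | k , refl = subst (m ^ i ∣_) (sym (^-distribˡ-+-* m i k)) (m∣m*n (m ^ k))

-- ν≥ p x k unfolds to p ^ k ∣ ∣ x ∣, from which neither x nor k can be inferred;
-- hence the implicit arguments passed explicitly below.
module _ {p : ℕ} where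

  ν≥-anti : ∀ {x i j} → i ≤ j → ν≥ p x j → ν≥ p x i
  ν≥-anti i≤j = ∣-trans (^-monoʳ-∣ p i≤j)

  ν>⇒ν≥ : ∀ {x k} → ν> p x k → ν≥ p x k
  ν>⇒ν≥ {x} {k} = ν≥-anti {x} {k} (n≤1+n k)

  private
    signed : ∀ x {d} → d ∣ ℤ.∣ x ∣ → + d ∣ˢ x
    signed x = ∣ᵤ⇒∣

    unsigned : ∀ x {d} → + d ∣ˢ x → d ∣ ℤ.∣ x ∣
    unsigned x = ∣⇒∣ᵤ

  ν≥-sub : ∀ {x y k} → ν≥ p x k → ν≥ p y k → ν≥ p (x - y) k
  ν≥-sub {x} {y} px py = unsigned (x - y) (∣m∣n⇒∣m-n (signed x px) (signed y py))

  ν≥-sub-cancelʳ : ∀ {x y k} → ν≥ p (x - y) k → ν≥ p y k → ν≥ p x k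
  ν≥-sub-cancelʳ {x} {y} pxy py =
    unsigned x (∣m+n∣n⇒∣m (signed (x - y) pxy) (∣m⇒∣-m (signed y py)))

  ν≥-sub-cancelˡ : ∀ {x y k} → ν≥ p x k → ν≥ p (x - y) k → ν≥ p y k
  ν≥-sub-cancelˡ {x} {y} px pxy = unsigned y
    (subst (_ ∣ˢ_) (neg-involutive y) (∣m⇒∣-m (∣m+n∣m⇒∣n (signed (x - y) pxy) (signed x px))))

  ν>-sub-ν≡ : ∀ {x y k} → ν> p x k → ν≡ p y k → ν≡ p (x - y) k
  ν>-sub-ν≡ {x} {y} {k} px (py , p∤y) =
    ν≥-sub {x} {y} {k} (ν>⇒ν≥ {x} {k} px) py ,
    λ pxy → p∤y (ν≥-sub-cancelˡ {x} {y} {suc k} px pxy)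

  ν≡-sub-ν> : ∀ {x y k} → ν≡ p x k → ν> p y k → ν≡ p (x - y) k
  ν≡-sub-ν> {x} {y} {k} (px , p∤x) py =
    ν≥-sub {x} {y} {k} px (ν>⇒ν≥ {y} {k} py) ,
    λ pxy → p∤x (ν≥-sub-cancelʳ {x} {y} {suc k} pxy py)

  ν≤ν-sub : ∀ {x y k} → ¬ ν> p x k → ν≥ p y k → ν≤ν p x (x - y)
  ν≤ν-sub {x} {y} {k} p∤x py j px with j ≤? k
  ... | yes j≤k = ν≥-sub {x} {y} {j} px (ν≥-anti {y} {j} j≤k py)
  ... | no  j≰k = ⊥-elim (p∤x (ν≥-anti {x} {suc k} (≰⇒> j≰k) px))

  ν≡-persists : ∀ (S T : ℕ → ℤ) {n k} → (∀ m → S (suc m) ≡ S m - T m) →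
                (∀ m → n ≤ m → ν> p (T m) k) → ν≡ p (S n) k → ∀ m → n ≤ m → ν≡ p (S m) k
  ν≡-persists S T step pT pS m n≤m with m≤n⇒m<n∨m≡n n≤m
  ν≡-persists S T step pT pS m n≤m | inj₂ refl = pS
  ν≡-persists S T {k = k} step pT pS (suc m) n≤m | inj₁ (s≤s n≤m′) =
    subst (λ x → ν≡ p x k) (sym (step m))
      (ν≡-sub-ν> {S m} {T m} {k} (ν≡-persists S T {k = k} step pT pS m n≤m′) (pT m n≤m′))

  ν≡0-of-¬∣ : ∀ {m} → ¬ p ∣ m → ν≡ p (+ m) 0
  ν≡0-of-¬∣ {m} p∤m = 1∣ m , λ p*1∣m → p∤m (subst (_∣ m) (*-identityʳ p) p*1∣m)

  ν≡-nonZero : ∀ {m v} → p ∣ m → ν≡ p (+ m) v → NonZero v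
  ν≡-nonZero {m} {zero}  p∣m (_ , p∤m) = ⊥-elim (p∤m (subst (_∣ m) (sym (*-identityʳ p)) p∣m))
  ν≡-nonZero {v = suc _} _   _         = _

module _ {p : ℕ} (pp : Prime p) where

  private instance
    p≢0 : NonZero p
    p≢0 = prime⇒nonZero pp

  ν≡-* : ∀ {m n i j} → ν≡ p (+ m) i → ν≡ p (+ n) j → ν≡ p (+ (m * n)) (i + j)
  ν≡-* {i = i} {j} (divides-refl q , p∤m) (divides-refl r , p∤n) =
    subst (p ^ (i + j) ∣_) (sym m*n≡) (n∣m*n (q * r)) , p^1+i+j∤m*n
    where
    m*n≡ : q * p ^ i * (r * p ^ j) ≡ q * r * p ^ (i + j)
    m*n≡ = trans (interchange q (p ^ i) r (p ^ j)) (cong (q * r *_) (sym (^-distribˡ-+-* p i j)))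

    p∤q : ¬ p ∣ q
    p∤q p∣q = p∤m (*-monoˡ-∣ (p ^ i) p∣q)

    p∤r : ¬ p ∣ r
    p∤r p∣r = p∤n (*-monoˡ-∣ (p ^ j) p∣r)

    p^1+i+j∤m*n : ¬ p * p ^ (i + j) ∣ q * p ^ i * (r * p ^ j)
    p^1+i+j∤m*n h = [ p∤q , p∤r ] (euclidsLemma q r pp
      (*-cancelʳ-∣ (p ^ (i + j)) {{m^n≢0 p (i + j)}} (subst (p * p ^ (i + j) ∣_) m*n≡ h)))

  ν≡-^ : ∀ {m v} → ν≡ p (+ m) v → ∀ n → ν≡ p (+ (m ^ n)) (n * v)
  ν≡-^ _  zero    = 1∣ 1 , λ p*1∣1 → ¬prime[1] (subst Prime (trans (sym (*-identityʳ p)) (∣1⇒≡1 p*1∣1)) pp)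
  ν≡-^ {m} {v} hm (suc n) = ν≡-* {i = v} {n * v} hm (ν≡-^ {m} {v} hm n)

s-suc : ∀ z a b n → s z a b (suc n) ≡ s z a b n - + (a ^ n * b)
s-suc z a b n = begin
  z - + (b * (geom a n + a ^ n))               ≡⟨ cong (λ t → z - t) +b*[g+aⁿ]≡ ⟩
  z ℤ.+ - (+ (b * geom a n) ℤ.+ + (a ^ n * b)) ≡⟨ cong (λ t → z ℤ.+ t) (neg-distrib-+ (+ (b * geom a n)) _) ⟩
  z ℤ.+ (- + (b * geom a n) ℤ.+ - + (a ^ n * b)) ≡⟨ sym (+-assoc z _ _) ⟩
  s z a b n - + (a ^ n * b)                    ∎
  where
  open ≡-Reasoning
  +b*[g+aⁿ]≡ : + (b * (geom a n + a ^ n)) ≡ + (b * geom a n) ℤ.+ + (a ^ n * b)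
  +b*[g+aⁿ]≡ = trans (cong +_ (trans (*-distribˡ-+ b (geom a n) (a ^ n))
                                      (cong (λ t → b * geom a n + t) (*-comm b (a ^ n)))))
                     (pos-+ (b * geom a n) (a ^ n * b))

lemma2 : (a b : ℕ) (z : ℤ) (p : ℕ) → 1 < a → 1 ≤ b → Coprime a b →
         Prime p → p ∣ a → (v : ℕ) → ν≡ p (+ a) v →
         ((n : ℕ) → 1 ≤ n →
            (ν> p (s z a b n) (n * v) → ν≡ p (s z a b (suc n)) (n * v))
            × (¬ ν> p (s z a b n) (n * v) → ν≤ν p (s z a b n) (s z a b (suc n))))
         × ((n : ℕ) → 1 ≤ n → ν≡ p (s z a b (suc n)) (n * v) →
            (n₁ : ℕ) → n < n₁ → ν≡ p (s z a b n₁) (n * v))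
lemma2 a b z p _ _ a⊥b pp p∣a v ν[a]≡v =
  (λ n _ → ν-step-strict n , ν-step-weak n) ,
  (λ n _ → ν≡-persists {p} (s z a b) T {k = n * v} (s-suc z a b) (ν[T]-increasing n))
  where
  instance
    v≢0 : NonZero v
    v≢0 = ν≡-nonZero {m = a} p∣a ν[a]≡v

  p∤b : ¬ p ∣ b
  p∤b p∣b = ¬prime[1] (subst Prime (a⊥b (p∣a , p∣b)) pp)

  T : ℕ → ℤ
  T n = + (a ^ n * b)

  ν[T] : ∀ n → ν≡ p (T n) (n * v)
  ν[T] n = subst (ν≡ p (T n)) (+-identityʳ (n * v))
                 (ν≡-* pp {i = n * v} (ν≡-^ pp ν[a]≡v n) (ν≡0-of-¬∣ p∤b))

  ν[T]-increasing : ∀ n m → n < m → ν> p (T m) (n * v)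
  ν[T]-increasing n m n<m = ν≥-anti {p} {T m} (*-monoˡ-< v n<m) (proj₁ (ν[T] m))

  ν-step-strict : ∀ n → ν> p (s z a b n) (n * v) → ν≡ p (s z a b (suc n)) (n * v)
  ν-step-strict n h = subst (λ x → ν≡ p x (n * v)) (sym (s-suc z a b n))
                            (ν>-sub-ν≡ {p} {s z a b n} {T n} {n * v} h (ν[T] n))

  ν-step-weak : ∀ n → ¬ ν> p (s z a b n) (n * v) → ν≤ν p (s z a b n) (s z a b (suc n))
  ν-step-weak n h = subst (ν≤ν p (s z a b n)) (sym (s-suc z a b n))
                          (ν≤ν-sub {p} {s z a b n} {T n} {n * v} h (proj₁ (ν[T] n)))
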